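{- Let $W$ be a set of eight distinct MacMahon cubes and let $G_W$ be the spanning subgraph of $M$ defined below. If any of the following holds: (i) $G_W$ has fewer than eight edges and $\mathrm{Ba}\notin W$; (ii) $G_W$ has a connected component that is a tree and $\mathrm{Ba}\notin W$; (iii) $G_W$ has more than one connected component that is a tree; then the solution number of $W$ for the target $\mathrm{Ba}$ is $0$.
   Context: A MacMahon cube is a cube whose six faces are painted with the colors $1,\dots,6$, each used once, up to rotation (there are $30$ of them). At each vertex three faces meet; reading their colors clockwise as seen from outside gives a cyclic triple, and the corner number of the vertex is the cyclic rotation of this triple of smallest three-digit value; each MacMahon cube has $8$ distinct corner numbers. $\mathrm{Ba}$ denotes the MacMahon cube whose corner numbers are $\{123,134,146,162,253,265,354,456\}$. Every MacMahon cube other than $\mathrm{Ba}$ shares either $0$ or exactly $2$ corner numbers with $\mathrm{Ba}$, and exactly $20$ share $2$. $M$ is the multigraph whose vertex set is the $8$ corner numbers of $\mathrm{Ba}$, with one edge, labeled $C$, joining the two shared corner numbers for each MacMahon cube $C\neq\mathrm{Ba}$ sharing exactly two corner numbers with $\mathrm{Ba}$ (so $M$ has $20$ edges; some pairs of vertices are joined by two parallel edges, and $M$ has no loops). For a set $W$ of MacMahon cubes, $G_W$ is the subgraph of $M$ with all $8$ vertices and exactly the edges labeled by cubes in $W$. A solution for target $\mathrm{Ba}$ is a bijection $\sigma$ from $W$ to the corner numbers of $\mathrm{Ba}$ with $\sigma(C)$ a corner number of $C$ for all $C\in W$; the solution number is the number of such bijections. A single isolated vertex counts as a tree component. -}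

module Defs where

open import Data.Nat using (ℕ; zero; suc; _+_; _*_; _<ᵇ_; _<_; _≤_; _≟_)
open import Data.Bool using (Bool; true; false; if_then_else_; _xor_)
open import Data.Fin using (Fin; zero; suc; toℕ; inject₁; fromℕ)
open import Data.Vec using (Vec; []; _∷_; lookup; toList)
open import Data.List using (List; []; _∷_; map; filter; length; allFin)
open import Data.List.Relation.Unary.All using (All; all?)
open import Data.List.Membership.Propositional using (_∈_)
open import Data.List.Membership.DecPropositional _≟_ using (_∈?_)
open import Data.Product using (Σ; Σ-syntax; ∃; ∃-syntax; _×_; _,_)
open import Data.Empty using (⊥)
open import Function using (_∘_)
open import Function.Definitions using (Injective; Bijective)
open import Relation.Nullary using (¬_; Dec)
open import Relation.Nullary.Decidable using (_×-dec_; ¬?)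
open import Relation.Binary.PropositionalEquality using (_≡_; _≢_)

-- Faces of the cube: 0 = R(+x), 1 = L(-x), 2 = B(+y), 3 = F(-y),
--                    4 = U(+z), 5 = D(-z).
Face : Set
Face = Fin 6

-- A painting of the faces with the colours 1..6, each used once.
-- Colour k ∈ {1..6} is represented by the element k-1 of Fin 6.
record Coloring : Set where
  constructor mkColoring
  field
    col : Face → Fin 6
    col-inj : Injective _≡_ _≡_ col
open Coloring public

-- Generating quarter-turn rotations of the cube (as permutations of faces).
-- ρZ : quarter turn about the z-axis  (+x → +y → -x → -y → +x)
ρZ : Face → Face
ρZ zero = suc (suc zero)
ρZ (suc (suc zero)) = suc zero
ρZ (suc zero) = suc (suc (suc zero))
ρZ (suc (suc (suc zero))) = zero
ρZ f = f

-- ρX : quarter turn about the x-axis  (+y → +z → -y → -z → +y)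
ρX : Face → Face
ρX (suc (suc zero)) = suc (suc (suc (suc zero)))
ρX (suc (suc (suc (suc zero)))) = suc (suc (suc zero))
ρX (suc (suc (suc zero))) = suc (suc (suc (suc (suc zero))))
ρX (suc (suc (suc (suc (suc zero))))) = suc (suc zero)
ρX f = f

-- Two colorings represent the same MacMahon cube iff one is obtained from
-- the other by a rotation, i.e. by an element of the group generated by
-- ρZ and ρX (the full rotation group of the cube; since it is finite, the
-- orbit under forward applications of the generators is the group orbit).
data _≈rot_ : (Face → Fin 6) → (Face → Fin 6) → Set where
  same  : ∀ {c d} → (∀ f → c f ≡ d f) → c ≈rot d
  turnZ : ∀ {c d} → (c ∘ ρZ) ≈rot d → c ≈rot d
  turnX : ∀ {c d} → (c ∘ ρX) ≈rot d → c ≈rot d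

colNum : Coloring → Face → ℕ
colNum c f = suc (toℕ (col c f))

-- the cyclic rotation of (a,b,c) with smallest three-digit value,
-- i.e. the rotation starting with the smallest entry, as a number
digits : ℕ → ℕ → ℕ → ℕ
digits a b c = 100 * a + 10 * b + c

cornerNum : ℕ → ℕ → ℕ → ℕ
cornerNum a b c =
  if (a <ᵇ b) Data.Bool.∧ (a <ᵇ c) then digits a b c
  else if b <ᵇ c then digits b c a
  else digits c a b

xFace yFace zFace : Bool → Face
xFace true  = zero
xFace false = suc zero
yFace true  = suc (suc zero)
yFace false = suc (suc (suc zero))
zFace true  = suc (suc (suc (suc zero)))
zFace false = suc (suc (suc (suc (suc zero))))

-- vertices of the cube: sign vectors (sx, sy, sz) (true = +)
vertices : List (Bool × Bool × Bool)
vertices =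
  (true , true , true) ∷ (true , true , false) ∷ (true , false , true) ∷
  (true , false , false) ∷ (false , true , true) ∷ (false , true , false) ∷
  (false , false , true) ∷ (false , false , false) ∷ []

-- The three faces at vertex (sx,sy,sz) read clockwise from outside:
-- if the sign product is + then (x, z, y), otherwise (x, y, z).
cornerAt : Coloring → Bool × Bool × Bool → ℕ
cornerAt c (sx , sy , sz) with (sx xor sy) xor sz
... | false = cornerNum (colNum c (xFace sx)) (colNum c (yFace sy)) (colNum c (zFace sz))
... | true  = cornerNum (colNum c (xFace sx)) (colNum c (zFace sz)) (colNum c (yFace sy))
-- note: (sx xor sy) xor sz = true  iff an odd number of signs are +
--   i.e. sign product = + iff number of '-' signs is even iff
--   (number of '+' signs) is odd (3 or 1).

corners : Coloring → List ℕ
corners c = map (cornerAt c) vertices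

baCorner : Fin 8 → ℕ
baCorner = lookup (123 ∷ 134 ∷ 146 ∷ 162 ∷ 253 ∷ 265 ∷ 354 ∷ 456 ∷ [])

baList : List ℕ
baList = map baCorner (allFin 8)

IsBa : Coloring → Set
IsBa c = All (_∈ baList) (corners c) × All (_∈ corners c) baList

isBa? : (c : Coloring) → Dec (IsBa c)
isBa? c = all? (_∈? baList) (corners c) ×-dec all? (_∈? corners c) baList

sharedCount : Coloring → ℕ
sharedCount c = length (filter (_∈? corners c) baList)

-- C ≠ Ba shares exactly two corner numbers with Ba: C labels an edge of M
IsEdgeCube : Coloring → Set
IsEdgeCube c = ¬ IsBa c × sharedCount c ≡ 2

isEdgeCube? : (c : Coloring) → Dec (IsEdgeCube c)
isEdgeCube? c = ¬? (isBa? c) ×-dec (sharedCount c ≟ 2)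

Distinct : (Fin 8 → Coloring) → Set
Distinct W = ∀ i j → i ≢ j → ¬ (col (W i) ≈rot col (W j))

BaIn : (Fin 8 → Coloring) → Set
BaIn W = ∃[ i ] IsBa (W i)

-- The graph G_W: vertices Fin 8 (index into Ba's corner numbers),
-- edges = those i with W i labelling an edge of M; the edge labelled W i
-- joins the two corner numbers of Ba that are corner numbers of W i.
Joins : (Fin 8 → Coloring) → Fin 8 → Fin 8 → Fin 8 → Set
Joins W i u v = IsEdgeCube (W i) × u ≢ v
              × baCorner u ∈ corners (W i) × baCorner v ∈ corners (W i)

edgeCount : (Fin 8 → Coloring) → ℕ
edgeCount W = length (filter (λ i → isEdgeCube? (W i)) (allFin 8))

data Reach (W : Fin 8 → Coloring) : Fin 8 → Fin 8 → Set where
  here : ∀ {u} → Reach W u u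
  step : ∀ {u v w} i → Joins W i u v → Reach W v w → Reach W u w

record Cycle (W : Fin 8 → Coloring) : Set where
  field
    n      : ℕ
    es     : Fin n → Fin 8
    vs     : Fin (suc n) → Fin 8
    es-inj : Injective _≡_ _≡_ es
    vs-inj : Injective _≡_ _≡_ (vs ∘ inject₁)
    closed : vs (fromℕ n) ≡ vs zero
    joins  : ∀ j → Joins W (es j) (vs (inject₁ j)) (vs (suc j))
    nonempty : 1 ≤ n

-- the connected component of G_W containing u is a tree
-- (it is connected by construction; it is a tree iff it contains no cycle)
TreeComponent : (Fin 8 → Coloring) → Fin 8 → Set
TreeComponent W u = ¬ (Σ[ C ∈ Cycle W ] Reach W u (Cycle.vs C zero))

-- Solutions for target Ba: bijections σ : W → corners of Ba with
-- σ(C) a corner number of C.  The solution number is the number of these;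
-- it is 0 iff there is none.
Solution : (Fin 8 → Coloring) → Set
Solution W = Σ[ σ ∈ (Fin 8 → Fin 8) ]
  Bijective _≡_ _≡_ σ × (∀ i → baCorner (σ i) ∈ corners (W i))

{-# OPTIONS --safe #-}
-- Given a solution σ, every corner y of Ba is a corner number of its own cube τ y = σ⁻¹ y.
-- A check of all 720 colourings shows that a cube other than Ba sharing a corner number with Ba
-- shares exactly two, so τ y is an edge of G_W from y to another vertex, and distinct vertices
-- get distinct edges. Following these edges from u must eventually close a cycle, unless the walk
-- meets the vertex whose cube is Ba; so the component of u is a tree only if it contains that
-- vertex. Without Ba in W this rules out tree components and makes all eight cubes edges; with Ba
-- in W, Distinct lets Ba occur only once, so at most one component is a tree.
module Submission where

open import Defs
open import Data.Bool using (Bool; true; false; _xor_)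
open import Data.Empty using (⊥-elim)
open import Data.Fin as Fin using (Fin; zero; suc; toℕ; fromℕ; fromℕ<; inject₁)
import Data.Fin.Properties as Fin
open import Data.List using (List; []; _∷_; [_]; _++_; map; filter; length; concatMap; allFin)
open import Data.List.Membership.Propositional using (_∈_; _∉_)
open import Data.List.Membership.Propositional.Properties
  using (∈-concatMap⁺; ∈-map⁺; ∈-filter⁺; ∈-allFin)
open import Data.List.Properties using (filter-all)
open import Data.List.Relation.Unary.All as All using (All; all?)
import Data.List.Relation.Unary.Any as Any
open import Data.Maybe as Maybe using (Maybe; from-just; _<∣>_)
open import Data.Maybe.Effectful using (applicative)
open import Data.Nat using (ℕ; zero; suc; _+_; _<_; _≤_; _≟_; s≤s; z≤n)
open import Data.Nat.GeneralisedArithmetic using (fold; fold-+)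
import Data.Nat.Properties as ℕ
open import Data.List.Membership.DecPropositional _≟_ using (_∈?_)
open import Data.Product using (Σ-syntax; ∃-syntax; ∃₂; _×_; _,_; proj₁; proj₂)
open import Data.Sum using (_⊎_; inj₁; inj₂)
open import Data.Vec using (Vec; []; _∷_; lookup; tabulate)
import Data.Vec.Membership.Propositional as Vec
open import Data.Vec.Properties using (lookup∘tabulate)
open import Data.Vec.Relation.Unary.Any.Properties using (tabulate⁻)
open import Effect.Applicative using (RawApplicative)
open import Function using (_∘_)
open import Function.Definitions using (Injective)
open import Level using (0ℓ)
open import Relation.Binary.Definitions using (DecidableEquality; tri<; tri≈; tri>)
open import Relation.Binary.PropositionalEquality
  using (_≡_; _≢_; _≗_; refl; sym; trans; cong; subst; module ≡-Reasoning)
open import Relation.Nullary using (¬_; Dec; yes; no)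
open import Relation.Nullary.Decidable using (_×-dec_; ¬?; dec⇒maybe; decidable-stable)

open RawApplicative (applicative {0ℓ}) using (_<$>_; _<*>_)

module _ {A : Set} (f : A → A) where

  record SimpleCycle (z : A) : Set where
    field
      period   : ℕ
      nonempty : 1 ≤ period
      closed   : fold z f period ≡ z
      simple   : ∀ {a b} → a < period → b < period → fold z f a ≡ fold z f b → a ≡ b

  module _ (_≟ᴬ_ : DecidableEquality A) {z : A} where

    Returns : ℕ → Set
    Returns k = fold z f (suc k) ≡ z

    first-return : ∀ p → Returns p → ∃[ q ] (Returns q × ∀ {r} → r < q → ¬ Returns r)
    first-return p returns
      with Fin.¬∀⟶∃¬-smallest (suc p) (¬_ ∘ Returns ∘ toℕ) (λ i → ¬? (_ ≟ᴬ z)) returns-by-p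
      where
      returns-by-p : ¬ (∀ (i : Fin (suc p)) → ¬ Returns (toℕ i))
      returns-by-p never = never (fromℕ p) (subst Returns (sym (Fin.toℕ-fromℕ p)) returns)
    ... | i , ¬¬returns , earlier =
      toℕ i , decidable-stable (_ ≟ᴬ z) ¬¬returns , λ r<i →
        subst (¬_ ∘ Returns) (trans (Fin.toℕ-inject (fromℕ< r<i)) (Fin.toℕ-fromℕ< r<i))
              (earlier (fromℕ< r<i))

    periodic⇒simpleCycle : ∀ p → Returns p → SimpleCycle z
    periodic⇒simpleCycle p returns with first-return p returns
    ... | q , closed , minimal = record
      { period = suc q ; nonempty = s≤s z≤n ; closed = closed ; simple = simple }
      where
      -- Shifting a repeat f^a z = f^b z by o = q - b steps returns to z after o + a + 1 ≤ q steps.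
      no-repeat : ∀ {a b} → a < b → b < suc q → fold z f a ≢ fold z f b
      no-repeat {a} {b} a<b (s≤s b≤q) repeat with ℕ.m≤n⇒∃[o]m+o≡n b≤q
      ... | o , b+o≡q = minimal (subst (o + a <_) o+b≡q (ℕ.+-monoʳ-< o a<b)) (begin
        f (fold z f (o + a))       ≡⟨ cong f (fold-+ z f o) ⟩
        f (fold (fold z f a) f o)  ≡⟨ cong (λ x → f (fold x f o)) repeat ⟩
        f (fold (fold z f b) f o)  ≡⟨ cong f (sym (fold-+ z f o)) ⟩
        f (fold z f (o + b))       ≡⟨ cong (λ k → fold z f (suc k)) o+b≡q ⟩
        fold z f (suc q)           ≡⟨ closed ⟩
        z                          ∎)
        where
        open ≡-Reasoning
        o+b≡q : o + b ≡ q
        o+b≡q = trans (ℕ.+-comm o b) b+o≡q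

      simple : ∀ {a b} → a < suc q → b < suc q → fold z f a ≡ fold z f b → a ≡ b
      simple {a} {b} a<l b<l repeat with ℕ.<-cmp a b
      ... | tri< a<b _ _ = ⊥-elim (no-repeat a<b b<l repeat)
      ... | tri≈ _ a≡b _ = a≡b
      ... | tri> _ _ b<a = ⊥-elim (no-repeat b<a a<l (sym repeat))

eventually-simpleCycle : ∀ {n} (f : Fin n → Fin n) x → ∃[ m ] SimpleCycle f (fold x f m)
eventually-simpleCycle {n} f x
  with Fin.pigeonhole (ℕ.n<1+n n) (λ (k : Fin (suc n)) → fold x f (toℕ k))
... | i , j , i<j , repeat with ℕ.m≤n⇒∃[o]m+o≡n i<j
... | o , 1+i+o≡j = toℕ i , periodic⇒simpleCycle f Fin._≟_ o (begin
  fold (fold x f (toℕ i)) f (suc o)  ≡⟨ sym (fold-+ x f (suc o)) ⟩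
  fold x f (suc o + toℕ i)           ≡⟨ cong (fold x f) o+1+i≡j ⟩
  fold x f (toℕ j)                   ≡⟨ sym repeat ⟩
  fold x f (toℕ i)                   ∎)
  where
  open ≡-Reasoning
  o+1+i≡j : suc o + toℕ i ≡ toℕ j
  o+1+i≡j = trans (cong suc (ℕ.+-comm o (toℕ i))) 1+i+o≡j

module _ {A : Set} where

  other : {y a : A} → Dec (y ≡ a) → A → A
  other         (yes _) b = b
  other {a = a} (no _)  _ = a

  other-≢ : ∀ {y a b} → a ≢ b → (y≟a : Dec (y ≡ a)) → y ≢ other y≟a b
  other-≢ a≢b (yes refl) = a≢b
  other-≢ a≢b (no y≢a)   = y≢a

  other-pres : ∀ {P : A → Set} {y a b} → P a → P b → (y≟a : Dec (y ≡ a)) → P (other y≟a b)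
  other-pres pa pb (yes _) = pb
  other-pres pa pb (no _)  = pa

module _ {n : ℕ} where

  open import Data.Vec.Membership.DecPropositional (Fin._≟_ {n}) using () renaming (_∈?_ to _∈ᵥ?_)

  extensions : ∀ {k} → Vec (Fin n) k → List (Vec (Fin n) (suc k))
  extensions v = map (_∷ v) (filter (¬? ∘ (_∈ᵥ? v)) (allFin n))

  injections : (k : ℕ) → List (Vec (Fin n) k)
  injections zero    = [ [] ]
  injections (suc k) = concatMap extensions (injections k)

  tabulate∈injections : ∀ k (g : Fin k → Fin n) → Injective _≡_ _≡_ g →
                        tabulate g ∈ injections k
  tabulate∈injections zero    g g-inj = Any.here refl
  tabulate∈injections (suc k) g g-inj = ∈-concatMap⁺ extensions (Any.map
    (λ { refl → ∈-map⁺ (_∷ _) (∈-filter⁺ (¬? ∘ (_∈ᵥ? _)) (∈-allFin (g zero)) fresh) })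
    (tabulate∈injections k (g ∘ suc) (Fin.suc-injective ∘ g-inj)))
    where
    fresh : ¬ g zero Vec.∈ tabulate (g ∘ suc)
    fresh g0∈ = let (j , g0≡gj) = tabulate⁻ g0∈ in Fin.0≢1+n (g-inj g0≡gj)

≈rot-respˡ : ∀ {c c′ d} → c ≗ c′ → c′ ≈rot d → c ≈rot d
≈rot-respˡ c≗c′ (same c′≗d) = same (λ f → trans (c≗c′ f) (c′≗d f))
≈rot-respˡ c≗c′ (turnZ r)   = turnZ (≈rot-respˡ (c≗c′ ∘ ρZ) r)
≈rot-respˡ c≗c′ (turnX r)   = turnX (≈rot-respˡ (c≗c′ ∘ ρX) r)

≈rot-trans : ∀ {c d e} → c ≈rot d → d ≈rot e → c ≈rot e
≈rot-trans (same c≗d) r′ = ≈rot-respˡ c≗d r′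
≈rot-trans (turnZ r)  r′ = turnZ (≈rot-trans r r′)
≈rot-trans (turnX r)  r′ = turnX (≈rot-trans r r′)

turn : Bool → Face → Face
turn true  = ρZ
turn false = ρX

rotate : List Bool → (Face → Fin 6) → Face → Fin 6
rotate []       c = c
rotate (b ∷ bs) c = rotate bs (c ∘ turn b)

rotate-≈rot : ∀ bs {c d} → rotate bs c ≗ d → c ≈rot d
rotate-≈rot []           = same
rotate-≈rot (true ∷ bs)  = turnZ ∘ rotate-≈rot bs
rotate-≈rot (false ∷ bs) = turnX ∘ rotate-≈rot bs

wordsUpTo : ℕ → List (List Bool)
wordsUpTo zero    = [ [] ]
wordsUpTo (suc n) = [] ∷ map (true ∷_) (wordsUpTo n) ++ map (false ∷_) (wordsUpTo n)

-- Every rotation of the cube is a word of length at most 5 in ρZ and ρX.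
findRotation : ∀ c d → Maybe (c ≈rot d)
findRotation c d = Maybe.map ((λ (bs , c≗d) → rotate-≈rot bs c≗d) ∘ Any.satisfied)
  (dec⇒maybe (Any.any? (λ bs → Fin.all? λ f → rotate bs c f Fin.≟ d f) (wordsUpTo 5)))

colourNum : (Face → Fin 6) → Face → ℕ
colourNum g f = suc (toℕ (g f))

-- cornerAt on bare colouring functions, as needed by the enumeration; corners c and
-- cornersOf (col c) agree definitionally.
cornerAtOf : (Face → Fin 6) → Bool × Bool × Bool → ℕ
cornerAtOf g (sx , sy , sz) with (sx xor sy) xor sz
... | false = cornerNum (colourNum g (xFace sx)) (colourNum g (yFace sy)) (colourNum g (zFace sz))
... | true  = cornerNum (colourNum g (xFace sx)) (colourNum g (zFace sz)) (colourNum g (yFace sy))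

cornersOf : (Face → Fin 6) → List ℕ
cornersOf g = map (cornerAtOf g) vertices

IsBaCorners : List ℕ → Set
IsBaCorners L = All (_∈ baList) L × All (_∈ L) baList

SharedPair : List ℕ → Set
SharedPair L = ∃₂ λ a b → a ≢ b × baCorner a ∈ L × baCorner b ∈ L

baColours : Face → Fin 6
baColours = lookup (Fin.# 0 ∷ Fin.# 4 ∷ Fin.# 1 ∷ Fin.# 3 ∷ Fin.# 5 ∷ Fin.# 2 ∷ [])

data CornerKind (g : Face → Fin 6) : Set where
  ba         : IsBaCorners (cornersOf g) → g ≈rot baColours → baColours ≈rot g → CornerKind g
  disjoint   : (∀ k → baCorner k ∉ cornersOf g) → CornerKind g
  two-shared : ¬ IsBaCorners (cornersOf g) → length (filter (_∈? cornersOf g) baList) ≡ 2 →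
               SharedPair (cornersOf g) → CornerKind g

isBaCorners? : (L : List ℕ) → Dec (IsBaCorners L)
isBaCorners? L = all? (_∈? baList) L ×-dec all? (_∈? L) baList

disjoint? : (L : List ℕ) → Dec (∀ k → baCorner k ∉ L)
disjoint? L = Fin.all? λ k → ¬? (baCorner k ∈? L)

sharesTwo? : (L : List ℕ) → Dec (length (filter (_∈? L) baList) ≡ 2)
sharesTwo? L = length (filter (_∈? L) baList) ≟ 2

sharedPair? : (L : List ℕ) → Dec (SharedPair L)
sharedPair? L = Fin.any? λ a → Fin.any? λ b →
  ¬? (a Fin.≟ b) ×-dec baCorner a ∈? L ×-dec baCorner b ∈? L

-- Matching on isBaCorners? through a helper: a 'with' here makes Agda normalise the open
-- term cornersOf g, which exhausts memory.
findCornerKind : (g : Face → Fin 6) → Maybe (CornerKind g)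
findCornerKind g = byBa (isBaCorners? (cornersOf g))
  where
  byBa : Dec (IsBaCorners (cornersOf g)) → Maybe (CornerKind g)
  byBa (yes isBa) = ba isBa <$> findRotation g baColours <*> findRotation baColours g
  byBa (no ¬isBa) = (disjoint <$> dec⇒maybe (disjoint? (cornersOf g)))
    <∣> (two-shared ¬isBa <$> dec⇒maybe (sharesTwo? (cornersOf g))
                          <*> dec⇒maybe (sharedPair? (cornersOf g)))

abstract
  cornerKinds : All (CornerKind ∘ lookup) (injections 6)
  cornerKinds = from-just
    (All.sequenceA 0ℓ applicative {injections 6} (All.tabulate λ {v} _ → findCornerKind (lookup v)))

cornerKind : (c : Coloring) → CornerKind (lookup (tabulate (col c)))
cornerKind c = All.lookup cornerKinds (tabulate∈injections 6 (col c) (col-inj c))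

isBaCorners⇒≈rot-ba : ∀ {g} → CornerKind g → IsBaCorners (cornersOf g) →
                      g ≈rot baColours × baColours ≈rot g
isBaCorners⇒≈rot-ba (ba _ g≈ba ba≈g)       _    = g≈ba , ba≈g
isBaCorners⇒≈rot-ba (disjoint none)        isBa =
  ⊥-elim (none zero (All.lookup (proj₂ isBa) (∈-map⁺ baCorner (∈-allFin zero))))
isBaCorners⇒≈rot-ba (two-shared ¬isBa _ _) isBa = ⊥-elim (¬isBa isBa)

isBa⇒≈rot-ba : ∀ c → IsBa c → col c ≈rot baColours × baColours ≈rot col c
isBa⇒≈rot-ba c isBa =
  let c≈ba , ba≈c = isBaCorners⇒≈rot-ba (cornerKind c) isBa
  in ≈rot-respˡ (sym ∘ lookup∘tabulate (col c)) c≈ba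
   , ≈rot-trans ba≈c (same (lookup∘tabulate (col c)))

isBa-unique : ∀ c d → IsBa c → IsBa d → col c ≈rot col d
isBa-unique c d isBa-c isBa-d =
  ≈rot-trans (proj₁ (isBa⇒≈rot-ba c isBa-c)) (proj₂ (isBa⇒≈rot-ba d isBa-d))

partner : ∀ {g} → CornerKind g → Fin 8 → Fin 8
partner (two-shared _ _ (a , b , _)) y = other (y Fin.≟ a) b
partner _                            y = y

partner-joins : ∀ {g} (k : CornerKind g) {y} →
  ¬ IsBaCorners (cornersOf g) → baCorner y ∈ cornersOf g →
  (¬ IsBaCorners (cornersOf g) × length (filter (_∈? cornersOf g) baList) ≡ 2) ×
  y ≢ partner k y × baCorner y ∈ cornersOf g × baCorner (partner k y) ∈ cornersOf g
partner-joins (ba isBa _ _) ¬isBa _ = ⊥-elim (¬isBa isBa)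
partner-joins (disjoint none) {y} _ y∈ = ⊥-elim (none y y∈)
partner-joins {g} (two-shared _ two (a , b , a≢b , a∈ , b∈)) {y} ¬isBa y∈ =
  (¬isBa , two) , other-≢ a≢b (y Fin.≟ a) , y∈ ,
  other-pres {P = λ k → baCorner k ∈ cornersOf g} a∈ b∈ (y Fin.≟ a)

shared⇒joins : ∀ W i {y} → ¬ IsBa (W i) → baCorner y ∈ corners (W i) →
               Joins W i y (partner (cornerKind (W i)) y)
shared⇒joins W i = partner-joins (cornerKind (W i))

module _ (W : Fin 8 → Coloring) where

  joins-sym : ∀ {i u v} → Joins W i u v → Joins W i v u
  joins-sym (edge , u≢v , u∈ , v∈) = edge , u≢v ∘ sym , v∈ , u∈

  reach-snoc : ∀ {i u v w} → Reach W u v → Joins W i v w → Reach W u w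
  reach-snoc here         j′ = step _ j′ here
  reach-snoc (step i j r) j′ = step i j (reach-snoc r j′)

  reach-sym : ∀ {u v} → Reach W u v → Reach W v u
  reach-sym here         = here
  reach-sym (step i j r) = reach-snoc (reach-sym r) (joins-sym j)

  reach-trans : ∀ {u v w} → Reach W u v → Reach W v w → Reach W u w
  reach-trans here         r′ = r′
  reach-trans (step i j r) r′ = step i j (reach-trans r r′)

  module _ (edge next : Fin 8 → Fin 8) (edge-inj : Injective _≡_ _≡_ edge) (x : Fin 8)
           (out : ∀ y → Reach W x y → Joins W (edge y) y (next y)) where

    reach-orbit : ∀ k → Reach W x (fold x next k)
    reach-orbit zero    = here
    reach-orbit (suc k) = reach-snoc (reach-orbit k) (out _ (reach-orbit k))

    simpleCycle⇒cycle : ∃[ m ] SimpleCycle next (fold x next m) →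
                        Σ[ C ∈ Cycle W ] Reach W x (Cycle.vs C zero)
    simpleCycle⇒cycle (m , cyc) = cycle , reach-orbit m
      where
      open SimpleCycle cyc

      orbit : ∀ {l} → Fin l → Fin 8
      orbit k = fold (fold x next m) next (toℕ k)

      orbit-inj : Injective _≡_ _≡_ (orbit {period})
      orbit-inj {a} {b} = Fin.toℕ-injective ∘ simple (Fin.toℕ<n a) (Fin.toℕ<n b)

      orbit-inject₁ : ∀ {l} (k : Fin l) → orbit (inject₁ k) ≡ orbit k
      orbit-inject₁ k = cong (fold (fold x next m) next) (Fin.toℕ-inject₁ k)

      out-orbit : (k : Fin period) → Joins W (edge (orbit k)) (orbit (inject₁ k)) (orbit (suc k))
      out-orbit k = subst (λ v → Joins W (edge (orbit k)) v (next (orbit k))) (sym (orbit-inject₁ k))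
        (out (orbit k) (subst (Reach W x) (fold-+ x next (toℕ k)) (reach-orbit (toℕ k + m))))

      cycle : Cycle W
      cycle = record
        { n        = period
        ; es       = edge ∘ orbit
        ; vs       = orbit
        ; es-inj   = orbit-inj ∘ edge-inj
        ; vs-inj   = λ {a} {b} e →
            orbit-inj (trans (sym (orbit-inject₁ a)) (trans e (orbit-inject₁ b)))
        ; closed   = trans (cong (fold (fold x next m) next) (Fin.toℕ-fromℕ period)) closed
        ; joins    = out-orbit
        ; nonempty = nonempty
        }

    cycle-from-out-edges : Σ[ C ∈ Cycle W ] Reach W x (Cycle.vs C zero)
    cycle-from-out-edges = simpleCycle⇒cycle (eventually-simpleCycle next x)

module _ (W : Fin 8 → Coloring) (solution : Solution W) where

  private
    σ : Fin 8 → Fin 8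
    σ = proj₁ solution

    σ-corner : ∀ i → baCorner (σ i) ∈ corners (W i)
    σ-corner = proj₂ (proj₂ solution)

    τ : Fin 8 → Fin 8
    τ y = proj₁ (proj₂ (proj₁ (proj₂ solution)) y)

    σ∘τ : ∀ y → σ (τ y) ≡ y
    σ∘τ y = proj₂ (proj₂ (proj₁ (proj₂ solution)) y) refl

    τ-inj : Injective _≡_ _≡_ τ
    τ-inj {y} {y′} τy≡τy′ = trans (sym (σ∘τ y)) (trans (cong σ τy≡τy′) (σ∘τ y′))

    τ-corner : ∀ y → baCorner y ∈ corners (W (τ y))
    τ-corner y = subst (λ k → baCorner k ∈ corners (W (τ y))) (σ∘τ y) (σ-corner (τ y))

  no-Ba⇒edgeCount≡8 : ¬ BaIn W → edgeCount W ≡ 8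
  no-Ba⇒edgeCount≡8 no-Ba = cong length (filter-all (λ i → isEdgeCube? (W i))
    (All.tabulate λ {i} _ → proj₁ (shared⇒joins W i {σ i} (λ isBa → no-Ba (i , isBa)) (σ-corner i))))

  treeComponent-reaches-Ba : ∀ {u} → TreeComponent W u →
                             ¬ (∀ y → Reach W u y → ¬ IsBa (W (τ y)))
  treeComponent-reaches-Ba {u} tree avoids-Ba = tree (cycle-from-out-edges W τ
    (λ y → partner (cornerKind (W (τ y))) y) τ-inj u
    (λ y u→y → shared⇒joins W (τ y) {y} (avoids-Ba y u→y) (τ-corner y)))

  treeComponents-reach : Distinct W → ∀ {u v} → TreeComponent W u → TreeComponent W v →
                         ¬ ¬ Reach W u v
  treeComponents-reach distinct tree-u tree-v u↛v =
    treeComponent-reaches-Ba tree-u λ y u→y isBa-y →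
    treeComponent-reaches-Ba tree-v λ y′ v→y′ isBa-y′ →
      distinct (τ y) (τ y′)
        (λ τy≡τy′ → u↛v (reach-trans W u→y
          (subst (λ t → Reach W t _) (sym (τ-inj τy≡τy′)) (reach-sym W v→y′))))
        (isBa-unique (W (τ y)) (W (τ y′)) isBa-y isBa-y′)

lemma5 : (W : Fin 8 → Coloring) → Distinct W →
    ((edgeCount W < 8 × ¬ BaIn W)
      ⊎ ((∃[ u ] TreeComponent W u) × ¬ BaIn W)
      ⊎ (∃[ u ] ∃[ v ] (¬ Reach W u v × TreeComponent W u × TreeComponent W v))) →
    ¬ Solution W
lemma5 W distinct (inj₁ (few-edges , no-Ba)) solution =
  ℕ.<-irrefl (no-Ba⇒edgeCount≡8 W solution no-Ba) few-edges
lemma5 W distinct (inj₂ (inj₁ ((u , tree) , no-Ba))) solution =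
  treeComponent-reaches-Ba W solution tree λ y _ isBa → no-Ba (_ , isBa)
lemma5 W distinct (inj₂ (inj₂ (u , v , u↛v , tree-u , tree-v))) solution =
  treeComponents-reach W solution distinct tree-u tree-v u↛v
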